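{- For any graph $G$, $\chi(G)\le \chi^d(G^\star)$ and $\mathrm{ch}(G)\le \mathrm{ch}^d(G^\star)$, where $G^\star$ is the 2-subdivision of $G$.
   Context: All graphs are simple. The 2-subdivision $G^\star$ of $G$ is obtained by inserting on each edge of $G$ a new vertex of degree two. $\chi(G)$ and $\mathrm{ch}(G)$ are the chromatic number and list chromatic number. A proper coloring is dynamic if every vertex of degree at least two has at least two distinct colors among its neighbors. $\chi^d(G)$ is the least $\ell$ such that $G$ has a dynamic coloring with $\ell$ colors; $\mathrm{ch}^d(G)$ is the least $\ell$ such that for every list assignment $L$ with $|L(v)|=\ell$ for all $v$ there is a dynamic coloring $c$ with $c(v)\in L(v)$ for all $v$. -}

module Defs where

open import Data.Nat using (ℕ; _≤_)
open import Data.Fin using (Fin) renaming (_<_ to _<ᶠ_)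
open import Data.Bool using (Bool; true)
open import Data.Product using (Σ; _×_; _,_; ∃-syntax)
open import Data.Sum using (_⊎_; inj₁; inj₂)
open import Data.Empty using (⊥)
open import Data.List using (List; length)
open import Data.List.Membership.Propositional using (_∈_)
open import Data.List.Relation.Unary.Unique.Propositional using (Unique)
open import Relation.Binary.PropositionalEquality using (_≡_; _≢_)
open import Relation.Nullary using (¬_)

record Graph (n : ℕ) : Set where
  field
    adj   : Fin n → Fin n → Bool
    sym   : ∀ u v → adj u v ≡ adj v u
    irref : ∀ v → adj v v ≡ true → ⊥

open Graph public

-- Generic (possibly non-Fin) vertex type with an adjacency relation,
-- used for the colouring notions so they apply to G and to G⋆ alike.
Rel : Set → Set₁
Rel V = V → V → Set

GAdj : ∀ {n} → Graph n → Rel (Fin n)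
GAdj G u v = adj G u v ≡ true

-- Edges of G: unordered pairs {i,j} represented as (i , j) with i < j.
Edge : ∀ {n} → Graph n → Set
Edge {n} G = Σ (Fin n × Fin n) λ { (i , j) → (i <ᶠ j) × GAdj G i j }

-- Vertices of the 2-subdivision G⋆: original vertices and one new vertex per edge.
SubV : ∀ {n} → Graph n → Set
SubV {n} G = Fin n ⊎ Edge G

SubAdj : ∀ {n} (G : Graph n) → Rel (SubV G)
SubAdj G (inj₁ a) (inj₁ b) = ⊥
SubAdj G (inj₁ a) (inj₂ ((i , j) , _)) = (a ≡ i) ⊎ (a ≡ j)
SubAdj G (inj₂ ((i , j) , _)) (inj₁ a) = (a ≡ i) ⊎ (a ≡ j)
SubAdj G (inj₂ _) (inj₂ _) = ⊥

module _ {V : Set} (A : Rel V) where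

  Proper : {C : Set} → (V → C) → Set
  Proper c = ∀ u v → A u v → c u ≢ c v

  DegAtLeast2 : V → Set
  DegAtLeast2 v = ∃[ u ] ∃[ w ] (u ≢ w × A v u × A v w)

  Dynamic : {C : Set} → (V → C) → Set
  Dynamic c = Proper c × (∀ v → DegAtLeast2 v → ∃[ u ] ∃[ w ] (A v u × A v w × c u ≢ c w))

  Colorable : ℕ → Set
  Colorable ℓ = Σ (V → Fin ℓ) Proper

  DynColorable : ℕ → Set
  DynColorable ℓ = Σ (V → Fin ℓ) Dynamic

  ListAssignment : ℕ → Set
  ListAssignment ℓ = Σ (V → List ℕ) λ L → ∀ v → Unique (L v) × length (L v) ≡ ℓ

  Choosable : ℕ → Set
  Choosable ℓ = (LA : ListAssignment ℓ) →
    Σ (V → ℕ) λ c → Proper c × (∀ v → c v ∈ Data.Product.proj₁ LA v)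

  DynChoosable : ℕ → Set
  DynChoosable ℓ = (LA : ListAssignment ℓ) →
    Σ (V → ℕ) λ c → Dynamic c × (∀ v → c v ∈ Data.Product.proj₁ LA v)

  IsLeast : (ℕ → Set) → ℕ → Set
  IsLeast P k = P k × (∀ ℓ → P ℓ → k ≤ ℓ)

  IsChromaticNumber : ℕ → Set
  IsChromaticNumber = IsLeast Colorable

  IsDynChromaticNumber : ℕ → Set
  IsDynChromaticNumber = IsLeast DynColorable

  IsChoiceNumber : ℕ → Set
  IsChoiceNumber = IsLeast Choosable

  IsDynChoiceNumber : ℕ → Set
  IsDynChoiceNumber = IsLeast DynChoosable

module Submission where

-- In the 2-subdivision G⋆ the new vertex x of an edge {i,j}
-- has exactly the two neighbours i and j, and i ≠ j.  So x has degree two,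
-- and a dynamic colouring of G⋆ must give i and j different colours.
-- Hence the restriction of any dynamic colouring of G⋆ to the original
-- vertices is a proper colouring of G.

open import Defs
open import Data.Nat using (ℕ; _≤_)
open import Data.Product using (_×_; _,_)
open import Data.Sum using (inj₁; inj₂)
open import Data.Sum.Properties using (inj₁-injective)
open import Data.Fin using (Fin) renaming (_<_ to _<ᶠ_)
open import Data.Fin.Properties using (<-cmp; <⇒≢)
open import Data.Empty using (⊥-elim)
open import Relation.Binary using (tri<; tri≈; tri>)
open import Relation.Binary.PropositionalEquality
  using (_≡_; _≢_; refl; trans) renaming (sym to ≡-sym)

lowerBound-mono : ∀ {P Q : ℕ → Set} {a b : ℕ} →
                  (∀ ℓ → P ℓ → Q ℓ) → (∀ ℓ → Q ℓ → a ≤ ℓ) → P b → a ≤ b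
lowerBound-mono {b = b} P⊆Q Q-bound Pb = Q-bound b (P⊆Q b Pb)

module _ {n : ℕ} (G : Graph n) where

  edgeVertex : ∀ {i j} → i <ᶠ j → GAdj G i j → SubV G
  edgeVertex {i} {j} i<j ij = inj₂ ((i , j) , i<j , ij)

  edgeVertex-deg2 : ∀ {i j} (i<j : i <ᶠ j) (ij : GAdj G i j) →
                    DegAtLeast2 (SubAdj G) (edgeVertex i<j ij)
  edgeVertex-deg2 {i} {j} i<j _ =
    inj₁ i , inj₁ j , (λ e → <⇒≢ i<j (inj₁-injective e)) , inj₁ refl , inj₂ refl

  neighbour-colour : ∀ {C : Set} (c : SubV G → C) {i j} (i<j : i <ᶠ j)
                     (ij : GAdj G i j) → c (inj₁ i) ≡ c (inj₁ j) →
                     ∀ u → SubAdj G (edgeVertex i<j ij) u → c u ≡ c (inj₁ i)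
  neighbour-colour c _ _ _     (inj₁ _) (inj₁ refl) = refl
  neighbour-colour c _ _ ci≡cj (inj₁ _) (inj₂ refl) = ≡-sym ci≡cj

  -- In a dynamic colouring of G⋆ the endpoints of every edge of G differ,
  -- since the edge vertex must see two distinct colours among i and j.
  endpoints-differ : ∀ {C : Set} (c : SubV G → C) → Dynamic (SubAdj G) c →
                     ∀ {i j} → i <ᶠ j → GAdj G i j → c (inj₁ i) ≢ c (inj₁ j)
  endpoints-differ c (_ , sees-two) {i} i<j ij ci≡cj
    with sees-two (edgeVertex i<j ij) (edgeVertex-deg2 i<j ij)
  ... | u , w , xu , xw , cu≢cw =
    cu≢cw (trans (same u xu) (≡-sym (same w xw)))
    where
    same : ∀ x → SubAdj G (edgeVertex i<j ij) x → c x ≡ c (inj₁ i)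
    same = neighbour-colour c i<j ij ci≡cj

  restrict : ∀ {C : Set} → (SubV G → C) → Fin n → C
  restrict c v = c (inj₁ v)

  restrict-proper : ∀ {C : Set} (c : SubV G → C) → Dynamic (SubAdj G) c →
                    Proper (GAdj G) (restrict c)
  restrict-proper c dyn u v uv with <-cmp u v
  ... | tri< u<v _ _ = endpoints-differ c dyn u<v uv
  ... | tri≈ _ refl _ = ⊥-elim (irref G u uv)
  ... | tri> _ _ v<u = λ cu≡cv →
    endpoints-differ c dyn v<u (trans (Graph.sym G v u) uv) (≡-sym cu≡cv)

  extend : ∀ {ℓ} → ListAssignment (GAdj G) ℓ → ListAssignment (SubAdj G) ℓ
  extend (L , L-ok) = L⋆ , L⋆-ok
    where
    L⋆ : SubV G → _
    L⋆ (inj₁ v)            = L v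
    L⋆ (inj₂ ((i , _) , _)) = L i
    L⋆-ok : ∀ v → _
    L⋆-ok (inj₁ v)            = L-ok v
    L⋆-ok (inj₂ ((i , _) , _)) = L-ok i

  dynColorable⇒colorable : ∀ ℓ → DynColorable (SubAdj G) ℓ → Colorable (GAdj G) ℓ
  dynColorable⇒colorable _ (c , dyn) = restrict c , restrict-proper c dyn

  dynChoosable⇒choosable : ∀ ℓ → DynChoosable (SubAdj G) ℓ → Choosable (GAdj G) ℓ
  dynChoosable⇒choosable _ choose LA with choose (extend LA)
  ... | c , dyn , c∈L = restrict c , restrict-proper c dyn , λ v → c∈L (inj₁ v)

fact1 : ∀ {n : ℕ} (G : Graph n) →
    (∀ a b → IsChromaticNumber (GAdj G) a → IsDynChromaticNumber (SubAdj G) b → a ≤ b)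
    × (∀ a b → IsChoiceNumber (GAdj G) a → IsDynChoiceNumber (SubAdj G) b → a ≤ b)
fact1 G =
  (λ _ _ (_ , χ-least) (χᵈ-holds , _) →
     lowerBound-mono (dynColorable⇒colorable G) χ-least χᵈ-holds)
  , (λ _ _ (_ , ch-least) (chᵈ-holds , _) →
     lowerBound-mono (dynChoosable⇒choosable G) ch-least chᵈ-holds)
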